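{- For $n\ge1$ let $f_{n,i}$ be the coefficient of $x^i$ in $(1+x+x^2)^n$. Then for all sufficiently large $n$ of the form $n=3s-1$ with $s$ a positive integer, and all integers $k$ with $0<k<s-1$, \[ f_{n,2k-1}+2f_{n,2k}+\sum_{i=2k+1}^{\lfloor (n+k)/2\rfloor} f_{n,i}-f_{n,n-k}<0, \] where the sum is empty if $2k+1>\lfloor (n+k)/2\rfloor$.
   Context: $\lfloor x\rfloor$ denotes the integer part of $x$. -}

module Defs where

open import Data.Nat using (ℕ; zero; suc; _+_; _∸_)
open import Data.Integer using (ℤ)
import Data.Integer as ℤ

-- coeff n i = coefficient of x^i in (1 + x + x^2)^n,
-- via (1+x+x^2)^(n+1) = (1+x+x^2)^n * (1+x+x^2).
coeff : ℕ → ℕ → ℕ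
coeff zero zero = 1
coeff zero (suc i) = 0
coeff (suc n) zero = coeff n zero
coeff (suc n) (suc zero) = coeff n 1 + coeff n 0
coeff (suc n) (suc (suc i)) = coeff n (suc (suc i)) + coeff n (suc i) + coeff n i

f : ℕ → ℕ → ℤ
f n i = ℤ.+ (coeff n i)

-- sumFrom a b g = Σ_{i=a}^{b} g i  (empty, i.e. 0, if a > b)
sumFromCount : ℕ → ℕ → (ℕ → ℤ) → ℤ
sumFromCount a zero g = ℤ.0ℤ
sumFromCount a (suc c) g = g a ℤ.+ sumFromCount (suc a) c g

sumFrom : ℕ → ℕ → (ℕ → ℤ) → ℤ
sumFrom a b g = sumFromCount a (suc b ∸ a) g

-- The coefficients cᵢ of (1 + x + x²)ⁿ form a log-concave sequence without internal
-- zeros (both properties survive multiplication by 1 + x + x²), hence they increase up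
-- to the middle index n. For n = 3t + 2, the identity (1 + x + x²)(Pⁿ)′ = n(1 + 2x)Pⁿ
-- read at two consecutive indices gives c₂ₜ₊₃ / c₂ₜ₊₂ ≥ 8/5 once t ≥ 36, and by
-- log-concavity all earlier ratios are at least 8/5 too. Up to m = ⌊(n + k)/2⌋ ≤ 2t the
-- terms therefore grow geometrically, so the positive part is at most (8/3 + 1) cₘ,
-- while c_{n−k} ≥ cₘ₊₃ ≥ (8/5)³ cₘ > (11/3) cₘ.
module Submission where

open import Defs
open import Data.Nat using (ℕ; suc; _+_; _*_; _∸_; _≤_; _<_; _/_)
open import Data.Integer using (ℤ; _-_; 0ℤ)
import Data.Integer as ℤ
import Data.Integer.Properties as ℤP
open import Data.Product using (∃-syntax; _,_)

open import Data.Nat using (zero; z≤n; s≤s; s≤s⁻¹; _^_; _≤?_; _≟_)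
open import Data.Nat.Base using (≢-nonZero; >-nonZero)
open import Data.Nat.Properties
open import Data.Nat.DivMod using (m*n/n≡m; /-monoˡ-≤; m<n*o⇒m/o<n; m/n*n≤m)
open import Data.Nat.Tactic.RingSolver using (solve-∀)
open import Data.Empty using (⊥; ⊥-elim)
open import Data.Sum using (_⊎_; inj₁; inj₂)
open import Relation.Nullary using (yes; no)
open import Relation.Binary.PropositionalEquality

coeff-vanishes : ∀ n j → n + n < j → coeff n j ≡ 0
coeff-vanishes zero (suc j) _ = refl
coeff-vanishes (suc n) (suc (suc j)) (s≤s 2n+1<j+1) rewrite +-suc n n with 2n+1<j+1
... | s≤s 2n<j = cong₂ _+_
  (cong₂ _+_ (coeff-vanishes n (2 + j) (m<n⇒m<1+n (m<n⇒m<1+n 2n<j)))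
             (coeff-vanishes n (1 + j) (m<n⇒m<1+n 2n<j)))
  (coeff-vanishes n j 2n<j)

coeff-positive : ∀ n j → j ≤ n + n → 0 < coeff n j
coeff-positive zero zero _ = s≤s z≤n
coeff-positive (suc n) zero _ = coeff-positive n zero z≤n
coeff-positive (suc n) (suc zero) _ = ≤-trans (coeff-positive n zero z≤n) (m≤n+m _ _)
coeff-positive (suc n) (suc (suc j)) (s≤s j+1≤2n+1) rewrite +-suc n n with j+1≤2n+1
... | s≤s j≤2n = ≤-trans (coeff-positive n j j≤2n) (m≤n+m _ _)

LogConcave : (ℕ → ℕ) → Set
LogConcave a = ∀ j → a j * a (2 + j) ≤ a (1 + j) * a (1 + j)

NoInternalZeros : (ℕ → ℕ) → Set
NoInternalZeros a = ∀ {p q r} → p ≤ q → q ≤ r → a q ≡ 0 → a p ≡ 0 ⊎ a r ≡ 0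

ratio-≤-trans : ∀ a b c d e f → a * d ≤ b * c → c * f ≤ d * e →
  (c * d ≡ 0 → a * f ≡ 0) → a * f ≤ b * e
ratio-≤-trans a b c d e f ad≤bc cf≤de degenerate with c * d ≟ 0
... | yes cd≡0 = subst (_≤ b * e) (sym (degenerate cd≡0)) z≤n
... | no cd≢0 = *-cancelˡ-≤ (c * d) {{≢-nonZero cd≢0}} (begin
  (c * d) * (a * f) ≡⟨ regroup₁ a c d f ⟩
  (a * d) * (c * f) ≤⟨ *-mono-≤ ad≤bc cf≤de ⟩
  (b * c) * (d * e) ≡⟨ regroup₂ b c d e ⟩
  (c * d) * (b * e) ∎)
  where
  open ≤-Reasoning
  regroup₁ : ∀ a c d f → (c * d) * (a * f) ≡ (a * d) * (c * f)
  regroup₁ = solve-∀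
  regroup₂ : ∀ b c d e → (b * c) * (d * e) ≡ (c * d) * (b * e)
  regroup₂ = solve-∀

-- Expanding both products, the five hypotheses bound the five cross terms
-- that do not occur in the square on the right.
window₃-≤ : ∀ x₀ x₁ x₂ x₃ x₄ →
  x₀ * x₂ ≤ x₁ * x₁ → x₂ * x₄ ≤ x₃ * x₃ →
  x₀ * x₃ ≤ x₁ * x₂ → x₁ * x₄ ≤ x₂ * x₃ → x₀ * x₄ ≤ x₁ * x₃ →
  (x₂ + x₁ + x₀) * (x₄ + x₃ + x₂) ≤ (x₃ + x₂ + x₁) * (x₃ + x₂ + x₁)
window₃-≤ x₀ x₁ x₂ x₃ x₄ h₀₂ h₂₄ h₀₃ h₁₄ h₀₄ = begin
  (x₂ + x₁ + x₀) * (x₄ + x₃ + x₂)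
    ≡⟨ expand-left x₀ x₁ x₂ x₃ x₄ ⟩
  common + (x₀ * x₂ + x₂ * x₄ + x₀ * x₃ + x₁ * x₄ + x₀ * x₄)
    ≤⟨ +-monoʳ-≤ common (+-mono-≤ (+-mono-≤ (+-mono-≤ (+-mono-≤ h₀₂ h₂₄) h₀₃) h₁₄) h₀₄) ⟩
  common + (x₁ * x₁ + x₃ * x₃ + x₁ * x₂ + x₂ * x₃ + x₁ * x₃)
    ≡⟨ expand-right x₁ x₂ x₃ ⟩
  (x₃ + x₂ + x₁) * (x₃ + x₂ + x₁) ∎
  where
  open ≤-Reasoning
  common : ℕ
  common = x₂ * x₂ + x₁ * x₂ + x₁ * x₃ + x₂ * x₃
  expand-left : ∀ x₀ x₁ x₂ x₃ x₄ → (x₂ + x₁ + x₀) * (x₄ + x₃ + x₂) ≡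
    (x₂ * x₂ + x₁ * x₂ + x₁ * x₃ + x₂ * x₃) + (x₀ * x₂ + x₂ * x₄ + x₀ * x₃ + x₁ * x₄ + x₀ * x₄)
  expand-left = solve-∀
  expand-right : ∀ x₁ x₂ x₃ →
    (x₂ * x₂ + x₁ * x₂ + x₁ * x₃ + x₂ * x₃) + (x₁ * x₁ + x₃ * x₃ + x₁ * x₂ + x₂ * x₃ + x₁ * x₃) ≡
    (x₃ + x₂ + x₁) * (x₃ + x₂ + x₁)
  expand-right = solve-∀

-- window₃ (shift₂ c) is the coefficient sequence of (1 + x + x²) · Σ cᵢ xⁱ.
window₃ : (ℕ → ℕ) → ℕ → ℕ
window₃ a j = a (2 + j) + a (1 + j) + a j

shift₂ : (ℕ → ℕ) → ℕ → ℕ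
shift₂ a zero = 0
shift₂ a (suc zero) = 0
shift₂ a (suc (suc j)) = a j

module _ {a : ℕ → ℕ} (concave : LogConcave a) (contiguous : NoInternalZeros a) where

  private
    outer-zero : ∀ {p r} → a p ≡ 0 ⊎ a r ≡ 0 → a p * a r ≡ 0
    outer-zero (inj₁ ap≡0) = cong (_* a _) ap≡0
    outer-zero (inj₂ ar≡0) = trans (cong (a _ *_) ar≡0) (*-zeroʳ (a _))

    product-zero : ∀ {p q q′ r} → p ≤ q → q ≤ r → p ≤ q′ → q′ ≤ r →
      a q * a q′ ≡ 0 → a p * a r ≡ 0
    product-zero p≤q q≤r p≤q′ q′≤r aqq′≡0 with m*n≡0⇒m≡0∨n≡0 (a _) aqq′≡0
    ... | inj₁ aq≡0 = outer-zero (contiguous p≤q q≤r aq≡0)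
    ... | inj₂ aq′≡0 = outer-zero (contiguous p≤q′ q′≤r aq′≡0)

  logConcave-cross₁ : ∀ j → a j * a (3 + j) ≤ a (1 + j) * a (2 + j)
  logConcave-cross₁ j =
    ratio-≤-trans (a j) (a (1 + j)) (a (1 + j)) (a (2 + j)) (a (2 + j)) (a (3 + j))
      (concave j) (concave (1 + j))
      (product-zero (n≤1+n j) (m≤n+m (1 + j) 2) (m≤n+m j 2) (n≤1+n (2 + j)))

  logConcave-cross₂ : ∀ j → a j * a (4 + j) ≤ a (1 + j) * a (3 + j)
  logConcave-cross₂ j =
    ratio-≤-trans (a j) (a (1 + j)) (a (2 + j)) (a (3 + j)) (a (3 + j)) (a (4 + j))
      (logConcave-cross₁ j) (concave (2 + j))
      (product-zero (m≤n+m j 2) (m≤n+m (2 + j) 2) (m≤n+m j 3) (n≤1+n (3 + j)))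

  window₃-logConcave : LogConcave (window₃ a)
  window₃-logConcave j =
    window₃-≤ (a j) (a (1 + j)) (a (2 + j)) (a (3 + j)) (a (4 + j))
      (concave j) (concave (2 + j))
      (logConcave-cross₁ j) (logConcave-cross₁ (1 + j)) (logConcave-cross₂ j)

shift₂-logConcave : ∀ {a} → LogConcave a → LogConcave (shift₂ a)
shift₂-logConcave concave zero = z≤n
shift₂-logConcave concave (suc zero) = z≤n
shift₂-logConcave concave (suc (suc j)) = concave j

coeff-suc : ∀ n j → coeff (suc n) j ≡ window₃ (shift₂ (coeff n)) j
coeff-suc n zero = sym (trans (+-identityʳ _) (+-identityʳ _))
coeff-suc n (suc zero) = sym (+-identityʳ _)
coeff-suc n (suc (suc j)) = refl

shift₂-coeff-noInternalZeros : ∀ n → NoInternalZeros (shift₂ (coeff n))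
shift₂-coeff-noInternalZeros n {zero} _ _ _ = inj₁ refl
shift₂-coeff-noInternalZeros n {suc zero} _ _ _ = inj₁ refl
shift₂-coeff-noInternalZeros n {suc (suc p)} {suc (suc q)} {suc (suc r)}
  (s≤s (s≤s _)) (s≤s (s≤s q≤r)) cq≡0 with q ≤? n + n
... | yes q≤2n = ⊥-elim (<⇒≢ (coeff-positive n q q≤2n) (sym cq≡0))
... | no q≰2n = inj₂ (coeff-vanishes n r (<-≤-trans (≰⇒> q≰2n) q≤r))

coeff-logConcave : ∀ n → LogConcave (coeff n)
coeff-logConcave zero zero = z≤n
coeff-logConcave zero (suc j) = z≤n
coeff-logConcave (suc n) j
  rewrite coeff-suc n j | coeff-suc n (1 + j) | coeff-suc n (2 + j) =
  window₃-logConcave (shift₂-logConcave (coeff-logConcave n))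
    (shift₂-coeff-noInternalZeros n) j

coeff-one : ∀ n → coeff n 1 ≡ n * coeff n 0
coeff-one zero = refl
coeff-one (suc n) = trans (cong (_+ coeff n 0) (coeff-one n)) (+-comm (n * coeff n 0) (coeff n 0))

private
  cancel-equal-summands : ∀ l r x y → l + y ≡ r + x → x ≡ y → l ≡ r
  cancel-equal-summands l r x y eq refl = +-cancelʳ-≡ x l r eq

-- Compare the coefficients of x^(i+1) in (1 + x + x²) · (Pⁿ)′ = n (1 + 2x) · Pⁿ, P = 1 + x + x².
coeff-recurrence : ∀ n i →
  (2 + i) * coeff n (2 + i) + (1 + i) * coeff n (1 + i) + i * coeff n i ≡
  n * coeff n (1 + i) + 2 * n * coeff n i
coeff-recurrence zero zero = refl
coeff-recurrence zero (suc i) = vanish i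
  where
  vanish : ∀ i → (3 + i) * 0 + (2 + i) * 0 + suc i * 0 ≡ 0 * 0 + 2 * 0 * 0
  vanish = solve-∀
coeff-recurrence (suc n) zero =
  cancel-equal-summands _ _ _ _ (regroup n (c 0) (c 1) (c 2))
    (cong₂ _+_ (coeff-recurrence n 0) (coeff-one n))
  where
  c : ℕ → ℕ
  c = coeff n
  regroup : ∀ n a₀ a₁ a₂ →
    (2 * (a₂ + a₁ + a₀) + 1 * (a₁ + a₀) + 0 * a₀) + ((n * a₁ + 2 * n * a₀) + n * a₀) ≡
    ((1 + n) * (a₁ + a₀) + 2 * (1 + n) * a₀) + ((2 * a₂ + 1 * a₁ + 0 * a₀) + a₁)
  regroup = solve-∀
coeff-recurrence (suc n) (suc zero) =
  cancel-equal-summands _ _ _ _ (regroup n (c 0) (c 1) (c 2) (c 3))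
    (cong₂ _+_ (cong₂ _+_ (coeff-recurrence n 1) (coeff-recurrence n 0)) (coeff-one n))
  where
  c : ℕ → ℕ
  c = coeff n
  regroup : ∀ n a₀ a₁ a₂ a₃ →
    (3 * (a₃ + a₂ + a₁) + 2 * (a₂ + a₁ + a₀) + 1 * (a₁ + a₀))
      + (((n * a₂ + 2 * n * a₁) + (n * a₁ + 2 * n * a₀)) + n * a₀) ≡
    ((1 + n) * (a₂ + a₁ + a₀) + 2 * (1 + n) * (a₁ + a₀))
      + (((3 * a₃ + 2 * a₂ + 1 * a₁) + (2 * a₂ + 1 * a₁ + 0 * a₀)) + a₁)
  regroup = solve-∀
coeff-recurrence (suc n) (suc (suc i)) =
  cancel-equal-summands _ _ _ _ (regroup n i (c i) (c (1 + i)) (c (2 + i)) (c (3 + i)) (c (4 + i)))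
    (cong₂ _+_ (cong₂ _+_ (coeff-recurrence n (2 + i)) (coeff-recurrence n (1 + i)))
      (coeff-recurrence n i))
  where
  c : ℕ → ℕ
  c = coeff n
  regroup : ∀ n i a₀ a₁ a₂ a₃ a₄ →
    ((4 + i) * (a₄ + a₃ + a₂) + (3 + i) * (a₃ + a₂ + a₁) + (2 + i) * (a₂ + a₁ + a₀))
      + (((n * a₃ + 2 * n * a₂) + (n * a₂ + 2 * n * a₁)) + (n * a₁ + 2 * n * a₀)) ≡
    ((1 + n) * (a₃ + a₂ + a₁) + 2 * (1 + n) * (a₂ + a₁ + a₀))
      + ((((4 + i) * a₄ + (3 + i) * a₃ + (2 + i) * a₂)
          + ((3 + i) * a₃ + (2 + i) * a₂ + (1 + i) * a₁))
          + ((2 + i) * a₂ + (1 + i) * a₁ + i * a₀))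
  regroup = solve-∀

coeff-middle-symmetric : ∀ p → coeff (suc p) (2 + p) ≡ coeff (suc p) p
coeff-middle-symmetric p = *-cancelˡ-≡ _ _ (2 + p) (+-cancelʳ-≡ rest _ _ (begin
  (2 + p) * c (2 + p) + rest                    ≡⟨ +-assoc ((2 + p) * c (2 + p)) _ _ ⟨
  (2 + p) * c (2 + p) + (1 + p) * c (1 + p) + p * c p ≡⟨ coeff-recurrence (suc p) p ⟩
  suc p * c (1 + p) + 2 * suc p * c p           ≡⟨ regroup p (c p) (c (1 + p)) ⟩
  (2 + p) * c p + rest                          ∎))
  where
  open ≡-Reasoning
  c : ℕ → ℕ
  c = coeff (suc p)
  rest : ℕ
  rest = (1 + p) * c (1 + p) + p * c p
  regroup : ∀ p x y → (1 + p) * y + 2 * (1 + p) * x ≡ (2 + p) * x + ((1 + p) * y + p * x)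
  regroup = solve-∀

square-cancel-≤ : ∀ {x y} → x * x ≤ y * y → x ≤ y
square-cancel-≤ x²≤y² = ≮⇒≥ (λ y<x → <⇒≱ (*-mono-< y<x y<x) x²≤y²)

coeff-peak : ∀ p → coeff (suc p) p ≤ coeff (suc p) (suc p)
coeff-peak p = square-cancel-≤
  (subst (λ x → coeff (suc p) p * x ≤ coeff (suc p) (suc p) * coeff (suc p) (suc p))
    (coeff-middle-symmetric p) (coeff-logConcave (suc p) p))

Grows : ℕ → ℕ → (ℕ → ℕ) → ℕ → Set
Grows p q a b = ∀ i → i < b → p * a i ≤ q * a (suc i)

-- The ratios a (suc i) / a i of a positive log-concave sequence decrease,
-- so a lower bound on the last one holds for all earlier ones.
logConcave-grows-downward : ∀ {a} p q top → LogConcave a →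
  (∀ i → i ≤ top → 0 < a (suc i)) →
  p * a top ≤ q * a (suc top) → Grows p q a (suc top)
logConcave-grows-downward {a} p q top concave positive at-top i (s≤s i≤top) =
  go (top ∸ i) i (m∸n+n≡m i≤top)
  where
  go : ∀ d i → d + i ≡ top → p * a i ≤ q * a (suc i)
  go zero i refl = at-top
  go (suc d) i d+1+i≡top =
    subst₂ _≤_ (*-comm (a i) p) (*-comm (a (1 + i)) q)
      (ratio-≤-trans (a i) (a (1 + i)) (a (1 + i)) (a (2 + i)) q p
        (concave i)
        (subst₂ _≤_ (*-comm p (a (1 + i))) (*-comm q (a (2 + i))) next)
        (λ product≡0 → ⊥-elim (<⇒≢ positive-product (sym product≡0))))
    where
    next : p * a (1 + i) ≤ q * a (2 + i)
    next = go d (1 + i) (trans (+-suc d i) d+1+i≡top)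
    positive-product : 0 < a (1 + i) * a (2 + i)
    positive-product = *-mono-<
      (positive i (subst (i ≤_) d+1+i≡top (m≤n+m i (suc d))))
      (positive (1 + i) (subst (1 + i ≤_) (trans (+-suc d i) d+1+i≡top) (m≤n+m (1 + i) d)))

coeff-increasing : ∀ n i → i < n → coeff n i ≤ coeff n (suc i)
coeff-increasing (suc p) i i<n =
  subst₂ _≤_ (*-identityˡ _) (*-identityˡ _)
    (logConcave-grows-downward 1 1 p (coeff-logConcave (suc p))
      (λ i i≤p → coeff-positive (suc p) (suc i) (≤-trans (s≤s i≤p) (m≤m+n (suc p) (suc p))))
      (subst₂ _≤_ (sym (*-identityˡ _)) (sym (*-identityˡ _)) (coeff-peak p))
      i i<n)

coeff-mono : ∀ n {i j} → i ≤ j → j ≤ n → coeff n i ≤ coeff n j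
coeff-mono n {i} {j} i≤j j≤n with m≤n⇒∃[o]m+o≡n i≤j
... | d , refl = go d j≤n
  where
  go : ∀ d → i + d ≤ n → coeff n i ≤ coeff n (i + d)
  go zero _ = ≤-reflexive (cong (coeff n) (sym (+-identityʳ i)))
  go (suc d) i+[1+d]≤n = begin
    coeff n i             ≤⟨ go d (<⇒≤ i+d<n) ⟩
    coeff n (i + d)       ≤⟨ coeff-increasing n (i + d) i+d<n ⟩
    coeff n (suc (i + d)) ≡⟨ cong (coeff n) (+-suc i d) ⟨
    coeff n (i + suc d)   ∎
    where
    open ≤-Reasoning
    i+d<n : i + d < n
    i+d<n = subst (_≤ n) (+-suc i d) i+[1+d]≤n

-- From 2z² = yz + 4xz ≤ yz + 4y²: z / y ≤ (1 + √33) / 4 < 7 / 4.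
quadratic-ratio-bound : ∀ {x y z} → 0 < y → x * z ≤ y * y → 2 * z ≡ y + 4 * x → 4 * z ≤ 7 * y
quadratic-ratio-bound {x} {y} {z} y>0 xz≤y² 2z≡y+4x = ≮⇒≥ refute
  where
  open ≤-Reasoning
  2z²≤yz+4y² : 2 * z * z ≤ y * z + 4 * (y * y)
  2z²≤yz+4y² = begin
    2 * z * z           ≡⟨ cong (_* z) 2z≡y+4x ⟩
    (y + 4 * x) * z     ≡⟨ distribute x y z ⟩
    y * z + 4 * (x * z) ≤⟨ +-monoʳ-≤ (y * z) (*-monoʳ-≤ 4 xz≤y²) ⟩
    y * z + 4 * (y * y) ∎
    where
    distribute : ∀ x y z → (y + 4 * x) * z ≡ y * z + 4 * (x * z)
    distribute = solve-∀
  5z≤8y : 7 * y < 4 * z → 5 * z ≤ 8 * y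
  5z≤8y 7y<4z = *-cancelˡ-≤ (4 * y) {{>-nonZero (*-monoʳ-< 4 y>0)}}
    (+-cancelˡ-≤ (8 * (y * z)) _ _ (begin
      8 * (y * z) + 4 * y * (5 * z) ≡⟨ regroup₁ y z ⟩
      (7 * y) * (4 * z)             ≤⟨ *-monoˡ-≤ (4 * z) (<⇒≤ 7y<4z) ⟩
      (4 * z) * (4 * z)             ≡⟨ regroup₂ z ⟩
      8 * (2 * z * z)               ≤⟨ *-monoʳ-≤ 8 2z²≤yz+4y² ⟩
      8 * (y * z + 4 * (y * y))     ≡⟨ regroup₃ y z ⟩
      8 * (y * z) + 4 * y * (8 * y) ∎))
    where
    regroup₁ : ∀ y z → 8 * (y * z) + 4 * y * (5 * z) ≡ (7 * y) * (4 * z)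
    regroup₁ = solve-∀
    regroup₂ : ∀ z → (4 * z) * (4 * z) ≡ 8 * (2 * z * z)
    regroup₂ = solve-∀
    regroup₃ : ∀ y z → 8 * (y * z + 4 * (y * y)) ≡ 8 * (y * z) + 4 * y * (8 * y)
    regroup₃ = solve-∀
  refute : 7 * y < 4 * z → ⊥
  refute 7y<4z = <-irrefl refl (begin-strict
    5 * (4 * z)     ≡⟨ regroup₁ z ⟩
    4 * (5 * z)     ≤⟨ *-monoʳ-≤ 4 (5z≤8y 7y<4z) ⟩
    4 * (8 * y)     <⟨ subst (suc (4 * (8 * y)) ≤_) (regroup₂ y) (m≤m+n _ (3 * y + 4)) ⟩
    5 * suc (7 * y) ≤⟨ *-monoʳ-≤ 5 7y<4z ⟩
    5 * (4 * z)     ∎)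
    where
    regroup₁ : ∀ z → 5 * (4 * z) ≡ 4 * (5 * z)
    regroup₁ = solve-∀
    regroup₂ : ∀ y → suc (4 * (8 * y)) + (3 * y + 4) ≡ 5 * suc (7 * y)
    regroup₂ = solve-∀

module _ {n t : ℕ} (n≡2+3t : n ≡ 2 + 3 * t) where

  private
    c : ℕ → ℕ
    c = coeff n

  coeff-identity₁ : 2 * c (2 + 2 * t) ≡ c (1 + 2 * t) + 4 * c (2 * t)
  coeff-identity₁ = *-cancelˡ-≡ _ _ (1 + t) (+-cancelʳ-≡ rest _ _ (begin
    (1 + t) * (2 * c (2 + 2 * t)) + rest
      ≡⟨ regroup₁ t (c (2 * t)) (c (1 + 2 * t)) (c (2 + 2 * t)) ⟨
    (2 + 2 * t) * c (2 + 2 * t) + (1 + 2 * t) * c (1 + 2 * t) + 2 * t * c (2 * t)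
      ≡⟨ coeff-recurrence n (2 * t) ⟩
    n * c (1 + 2 * t) + 2 * n * c (2 * t)
      ≡⟨ cong (λ x → x * c (1 + 2 * t) + 2 * x * c (2 * t)) n≡2+3t ⟩
    (2 + 3 * t) * c (1 + 2 * t) + 2 * (2 + 3 * t) * c (2 * t)
      ≡⟨ regroup₂ t (c (2 * t)) (c (1 + 2 * t)) ⟩
    (1 + t) * (c (1 + 2 * t) + 4 * c (2 * t)) + rest ∎))
    where
    open ≡-Reasoning
    rest : ℕ
    rest = (1 + 2 * t) * c (1 + 2 * t) + 2 * t * c (2 * t)
    regroup₁ : ∀ t a₀ a₁ a₂ → (2 + 2 * t) * a₂ + (1 + 2 * t) * a₁ + 2 * t * a₀ ≡
      (1 + t) * (2 * a₂) + ((1 + 2 * t) * a₁ + 2 * t * a₀)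
    regroup₁ = solve-∀
    regroup₂ : ∀ t a₀ a₁ → (2 + 3 * t) * a₁ + 2 * (2 + 3 * t) * a₀ ≡
      (1 + t) * (a₁ + 4 * a₀) + ((1 + 2 * t) * a₁ + 2 * t * a₀)
    regroup₂ = solve-∀

  coeff-identity₂ : (3 + 2 * t) * c (3 + 2 * t) ≡ t * c (2 + 2 * t) + (3 + 4 * t) * c (1 + 2 * t)
  coeff-identity₂ = +-cancelʳ-≡ rest _ _ (begin
    (3 + 2 * t) * c (3 + 2 * t) + rest
      ≡⟨ +-assoc ((3 + 2 * t) * c (3 + 2 * t)) _ _ ⟨
    (3 + 2 * t) * c (3 + 2 * t) + (2 + 2 * t) * c (2 + 2 * t) + (1 + 2 * t) * c (1 + 2 * t)
      ≡⟨ coeff-recurrence n (1 + 2 * t) ⟩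
    n * c (2 + 2 * t) + 2 * n * c (1 + 2 * t)
      ≡⟨ cong (λ x → x * c (2 + 2 * t) + 2 * x * c (1 + 2 * t)) n≡2+3t ⟩
    (2 + 3 * t) * c (2 + 2 * t) + 2 * (2 + 3 * t) * c (1 + 2 * t)
      ≡⟨ regroup t (c (1 + 2 * t)) (c (2 + 2 * t)) ⟩
    t * c (2 + 2 * t) + (3 + 4 * t) * c (1 + 2 * t) + rest ∎)
    where
    open ≡-Reasoning
    rest : ℕ
    rest = (2 + 2 * t) * c (2 + 2 * t) + (1 + 2 * t) * c (1 + 2 * t)
    regroup : ∀ t a₁ a₂ → (2 + 3 * t) * a₂ + 2 * (2 + 3 * t) * a₁ ≡
      (t * a₂ + (3 + 4 * t) * a₁) + ((2 + 2 * t) * a₂ + (1 + 2 * t) * a₁)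
    regroup = solve-∀

  coeff-positive-below-top : ∀ i → i ≤ 3 + 2 * t → 0 < c i
  coeff-positive-below-top i i≤3+2t = coeff-positive n i (≤-trans i≤3+2t
    (subst (3 + 2 * t ≤_) (trans (regroup t) (cong (λ x → x + x) (sym n≡2+3t)))
      (m≤m+n _ (1 + 4 * t))))
    where
    regroup : ∀ t → (3 + 2 * t) + (1 + 4 * t) ≡ (2 + 3 * t) + (2 + 3 * t)
    regroup = solve-∀

  coeff-ratio-at-top : 36 ≤ t → 8 * c (2 + 2 * t) ≤ 5 * c (3 + 2 * t)
  coeff-ratio-at-top 36≤t = *-cancelˡ-≤ (7 * (3 + 2 * t)) (begin
    (7 * (3 + 2 * t)) * (8 * c (2 + 2 * t))   ≡⟨ regroup₁ t C ⟩
    (56 * (3 + 2 * t)) * C                    ≤⟨ *-monoˡ-≤ C linear-bound ⟩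
    (115 * t + 60) * C                        ≡⟨ regroup₂ t C ⟩
    35 * t * C + 5 * (3 + 4 * t) * (4 * C)
      ≤⟨ +-monoʳ-≤ (35 * t * C) (*-monoʳ-≤ (5 * (3 + 4 * t)) 4C≤7B) ⟩
    35 * t * C + 5 * (3 + 4 * t) * (7 * B)    ≡⟨ regroup₃ t B C ⟩
    35 * (t * C + (3 + 4 * t) * B)            ≡⟨ cong (35 *_) coeff-identity₂ ⟨
    35 * ((3 + 2 * t) * D)                    ≡⟨ regroup₄ t D ⟩
    (7 * (3 + 2 * t)) * (5 * c (3 + 2 * t))   ∎)
    where
    open ≤-Reasoning
    B C D : ℕ
    B = c (1 + 2 * t)
    C = c (2 + 2 * t)
    D = c (3 + 2 * t)
    4C≤7B : 4 * C ≤ 7 * B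
    4C≤7B = quadratic-ratio-bound {c (2 * t)} {B} {C}
      (coeff-positive-below-top (1 + 2 * t) (m≤n+m _ 2)) (coeff-logConcave n (2 * t)) coeff-identity₁
    -- The only place where t ≥ 36 is used.
    linear-bound : 56 * (3 + 2 * t) ≤ 115 * t + 60
    linear-bound = begin
      56 * (3 + 2 * t)        ≡⟨ regroup t ⟩
      60 + 112 * t + 3 * 36   ≤⟨ +-monoʳ-≤ (60 + 112 * t) (*-monoʳ-≤ 3 36≤t) ⟩
      60 + 112 * t + 3 * t    ≡⟨ regroup′ t ⟩
      115 * t + 60            ∎
      where
      regroup : ∀ t → 56 * (3 + 2 * t) ≡ 60 + 112 * t + 3 * 36
      regroup = solve-∀
      regroup′ : ∀ t → 60 + 112 * t + 3 * t ≡ 115 * t + 60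
      regroup′ = solve-∀
    regroup₁ : ∀ t x → (7 * (3 + 2 * t)) * (8 * x) ≡ (56 * (3 + 2 * t)) * x
    regroup₁ = solve-∀
    regroup₂ : ∀ t x → (115 * t + 60) * x ≡ 35 * t * x + 5 * (3 + 4 * t) * (4 * x)
    regroup₂ = solve-∀
    regroup₃ : ∀ t y x → 35 * t * x + 5 * (3 + 4 * t) * (7 * y) ≡ 35 * (t * x + (3 + 4 * t) * y)
    regroup₃ = solve-∀
    regroup₄ : ∀ t x → 35 * ((3 + 2 * t) * x) ≡ (7 * (3 + 2 * t)) * (5 * x)
    regroup₄ = solve-∀

  coeff-grows : 36 ≤ t → Grows 8 5 c (3 + 2 * t)
  coeff-grows 36≤t = logConcave-grows-downward {c} 8 5 (2 + 2 * t) (coeff-logConcave n)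
    (λ i i≤2+2t → coeff-positive-below-top (suc i) (s≤s i≤2+2t)) (coeff-ratio-at-top 36≤t)

sumFromCountℕ : ℕ → ℕ → (ℕ → ℕ) → ℕ
sumFromCountℕ i zero a = 0
sumFromCountℕ i (suc l) a = a i + sumFromCountℕ (suc i) l a

sumFromCountℕ-snoc : ∀ i l a → sumFromCountℕ i (suc l) a ≡ sumFromCountℕ i l a + a (i + l)
sumFromCountℕ-snoc i zero a = trans (+-identityʳ (a i)) (cong a (sym (+-identityʳ i)))
sumFromCountℕ-snoc i (suc l) a = begin
  a i + sumFromCountℕ (suc i) (suc l) a           ≡⟨ cong (a i +_) (sumFromCountℕ-snoc (suc i) l a) ⟩
  a i + (sumFromCountℕ (suc i) l a + a (suc i + l)) ≡⟨ +-assoc (a i) _ _ ⟨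
  a i + sumFromCountℕ (suc i) l a + a (suc i + l)
    ≡⟨ cong (λ x → a i + sumFromCountℕ (suc i) l a + a x) (+-suc i l) ⟨
  a i + sumFromCountℕ (suc i) l a + a (i + suc l)   ∎
  where open ≡-Reasoning

grows-mono : ∀ {p q a b c} → b ≤ c → Grows p q a c → Grows p q a b
grows-mono b≤c grows i i<b = grows i (<-≤-trans i<b b≤c)

grows-sum-bound : ∀ {q d a} i l → Grows (q + d) q a (i + l) →
  d * sumFromCountℕ i (suc l) a ≤ (q + d) * a (i + l)
grows-sum-bound {q} {d} {a} i zero _ = begin
  d * (a i + 0)     ≡⟨ cong (d *_) (+-identityʳ (a i)) ⟩
  d * a i           ≤⟨ m≤n+m (d * a i) (q * a i) ⟩
  q * a i + d * a i ≡⟨ *-distribʳ-+ (a i) q d ⟨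
  (q + d) * a i     ≡⟨ cong (λ x → (q + d) * a x) (+-identityʳ i) ⟨
  (q + d) * a (i + 0) ∎
  where open ≤-Reasoning
grows-sum-bound {q} {d} {a} i (suc l) grows = begin
  d * sumFromCountℕ i (2 + l) a                       ≡⟨ cong (d *_) (sumFromCountℕ-snoc i (suc l) a) ⟩
  d * (sumFromCountℕ i (suc l) a + a (i + suc l))     ≡⟨ *-distribˡ-+ d _ _ ⟩
  d * sumFromCountℕ i (suc l) a + d * a (i + suc l)
    ≤⟨ +-monoˡ-≤ _ (grows-sum-bound {q} {d} {a} i l
         (grows-mono {q + d} {q} {a} (<⇒≤ i+l<i+[1+l]) grows)) ⟩
  (q + d) * a (i + l) + d * a (i + suc l)
    ≤⟨ +-monoˡ-≤ _ (grows (i + l) i+l<i+[1+l]) ⟩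
  q * a (suc (i + l)) + d * a (i + suc l)
    ≡⟨ cong (λ x → q * a x + d * a (i + suc l)) (+-suc i l) ⟨
  q * a (i + suc l) + d * a (i + suc l)               ≡⟨ *-distribʳ-+ (a (i + suc l)) q d ⟨
  (q + d) * a (i + suc l)                             ∎
  where
  open ≤-Reasoning
  i+l<i+[1+l] : i + l < i + suc l
  i+l<i+[1+l] = +-monoʳ-< i (n<1+n l)

grows-pow : ∀ {p q a b} k i → k + i ≤ b → Grows p q a b → p ^ k * a i ≤ q ^ k * a (k + i)
grows-pow zero i _ _ = ≤-refl
grows-pow {p} {q} {a} {b} (suc k) i k+i<b grows = begin
  p * p ^ k * a i           ≡⟨ regroup₁ p (p ^ k) (a i) ⟩
  p ^ k * (p * a i)         ≤⟨ *-monoʳ-≤ (p ^ k) (grows i (<-≤-trans (m<n+m i (s≤s z≤n)) k+i<b)) ⟩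
  p ^ k * (q * a (suc i))   ≡⟨ regroup₂ q (p ^ k) (a (suc i)) ⟨
  q * (p ^ k * a (suc i))
    ≤⟨ *-monoʳ-≤ q (grows-pow {p} {q} {a} k (suc i) (subst (_≤ b) (sym (+-suc k i)) k+i<b) grows) ⟩
  q * (q ^ k * a (k + suc i)) ≡⟨ cong (λ x → q * (q ^ k * a x)) (+-suc k i) ⟩
  q * (q ^ k * a (suc k + i)) ≡⟨ *-assoc q (q ^ k) _ ⟨
  q * q ^ k * a (suc k + i)   ∎
  where
  open ≤-Reasoning
  regroup₁ : ∀ x y z → x * y * z ≡ y * (x * z)
  regroup₁ = solve-∀
  regroup₂ : ∀ x y z → x * (y * z) ≡ y * (x * z)
  regroup₂ = solve-∀

-- With growth factor 8/5 the sum is at most (8/3 + 1) a e, and three more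
-- steps multiply by (8/5)³ = 512/125 > 11/3.
head-sum-bound : ∀ {a} j l e → j + suc l ≡ e → Grows 8 5 a (3 + e) → a (suc j) ≤ a e →
  0 < a (3 + e) → a j + 2 * a (suc j) + sumFromCountℕ (2 + j) l a < a (3 + e)
head-sum-bound {a} j l e refl grows y≤ae positive = *-cancelˡ-< 1536 _ _ (begin-strict
  1536 * (x + 2 * y + s)  ≡⟨ *-assoc 512 3 (x + 2 * y + s) ⟩
  512 * (3 * (x + 2 * y + s)) ≤⟨ *-monoʳ-≤ 512 bound-by-last ⟩
  512 * (11 * a e)        ≡⟨ regroup₁ (a e) ⟩
  11 * (512 * a e)        ≤⟨ *-monoʳ-≤ 11 (grows-pow {8} {5} {a} 3 e ≤-refl grows) ⟩
  11 * (125 * a (3 + e))  ≡⟨ *-assoc 11 125 (a (3 + e)) ⟨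
  1375 * a (3 + e)        <⟨ *-monoˡ-< (a (3 + e)) {{>-nonZero positive}} (m<m+n 1375 {161} (s≤s z≤n)) ⟩
  1536 * a (3 + e)        ∎)
  where
  open ≤-Reasoning
  x y s : ℕ
  x = a j
  y = a (suc j)
  s = sumFromCountℕ (2 + j) l a
  regroup₁ : ∀ z → 512 * (11 * z) ≡ 11 * (512 * z)
  regroup₁ = solve-∀
  regroup₂ : ∀ x y s → 3 * (x + 2 * y + s) ≡ 3 * (x + (y + s)) + 3 * y
  regroup₂ = solve-∀
  bound-by-last : 3 * (x + 2 * y + s) ≤ 11 * a e
  bound-by-last = begin
    3 * (x + 2 * y + s)         ≡⟨ regroup₂ x y s ⟩
    3 * (x + (y + s)) + 3 * y
      ≤⟨ +-mono-≤ (grows-sum-bound {5} {3} {a} j (suc l) (grows-mono {8} {5} {a} (m≤n+m _ 3) grows))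
                  (*-monoʳ-≤ 3 y≤ae) ⟩
    8 * a e + 3 * a e           ≡⟨ *-distribʳ-+ (a e) 8 3 ⟨
    11 * a e                    ∎

midpoint-lower : ∀ {n t k} → n ≡ 2 + 3 * t → k < t → 2 * k ≤ (n + k) / 2
midpoint-lower {t = t} {k} refl k<t with m≤n⇒∃[o]m+o≡n k<t
... | w , refl = subst (_≤ (2 + 3 * t + k) / 2) (m*n/n≡m (2 * k) 2)
  (/-monoˡ-≤ 2 (subst (2 * k * 2 ≤_) (regroup k w) (m≤m+n _ (5 + 3 * w))))
  where
  regroup : ∀ k w → 2 * k * 2 + (5 + 3 * w) ≡ 2 + 3 * (suc k + w) + k
  regroup = solve-∀

midpoint-upper : ∀ {n t k} → n ≡ 2 + 3 * t → k < t → (n + k) / 2 ≤ 2 * t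
midpoint-upper {t = t} {k} refl k<t with m≤n⇒∃[o]m+o≡n k<t
... | w , refl = s≤s⁻¹ (m<n*o⇒m/o<n {n = suc (2 * t)} {o = 2}
  (subst (suc (2 + 3 * t + k) ≤_) (regroup k w) (m≤m+n _ w)))
  where
  regroup : ∀ k w → suc (2 + 3 * (suc k + w) + k) + w ≡ suc (2 * (suc k + w)) * 2
  regroup = solve-∀

midpoint-gap : ∀ {n t k} → n ≡ 2 + 3 * t → k < t → 3 + (n + k) / 2 ≤ n ∸ k
midpoint-gap {n} {t} {k} refl k<t with m≤n⇒∃[o]m+o≡n k<t
... | w , refl = m+n≤o⇒m≤o∸n (3 + m) (s≤s⁻¹ (*-cancelʳ-< 2 _ _ (begin-strict
  (3 + m + k) * 2     ≡⟨ regroup₁ m k ⟩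
  m * 2 + (2 * k + 6) ≤⟨ +-monoˡ-≤ _ (m/n*n≤m (n + k) 2) ⟩
  n + k + (2 * k + 6) <⟨ subst (suc (n + k + (2 * k + 6)) ≤_) (regroup₂ k w) (m≤m+n _ (3 * w)) ⟩
  suc n * 2           ∎)))
  where
  open ≤-Reasoning
  m : ℕ
  m = (n + k) / 2
  regroup₁ : ∀ m k → (3 + m + k) * 2 ≡ m * 2 + (2 * k + 6)
  regroup₁ = solve-∀
  regroup₂ : ∀ k w →
    suc (2 + 3 * (suc k + w) + k + (2 * k + 6)) + 3 * w ≡ suc (2 + 3 * (suc k + w)) * 2
  regroup₂ = solve-∀

sumFromCount-pos : ∀ i l a → sumFromCount i l (λ j → ℤ.+ a j) ≡ ℤ.+ sumFromCountℕ i l a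
sumFromCount-pos i zero a = refl
sumFromCount-pos i (suc l) a =
  trans (cong (ℤ._+_ (ℤ.+ a i)) (sumFromCount-pos (suc i) l a)) (sym (ℤP.pos-+ (a i) _))

i<j⇒i-j<0 : ∀ {i j} → i ℤ.< j → i - j ℤ.< 0ℤ
i<j⇒i-j<0 {i} {j} i<j = subst (i - j ℤ.<_) (ℤP.+-inverseʳ j) (ℤP.+-monoˡ-< (ℤ.- j) i<j)

gap : ℕ → ℕ → ℤ
gap n k = f n (2 * k ∸ 1) ℤ.+ ℤ.+ 2 ℤ.* f n (2 * k)
  ℤ.+ sumFrom (suc (2 * k)) ((n + k) / 2) (f n) - f n (n ∸ k)

gap<0 : ∀ n k →
  coeff n (2 * k ∸ 1) + 2 * coeff n (2 * k)
    + sumFromCountℕ (suc (2 * k)) ((n + k) / 2 ∸ 2 * k) (coeff n) < coeff n (n ∸ k) →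
  gap n k ℤ.< 0ℤ
gap<0 n k lhs<rhs = subst (λ z → z - f n (n ∸ k) ℤ.< 0ℤ) as-integer (i<j⇒i-j<0 (ℤ.+<+ lhs<rhs))
  where
  x y s : ℕ
  x = coeff n (2 * k ∸ 1)
  y = coeff n (2 * k)
  s = sumFromCountℕ (suc (2 * k)) ((n + k) / 2 ∸ 2 * k) (coeff n)
  as-integer : ℤ.+ (x + 2 * y + s) ≡ f n (2 * k ∸ 1) ℤ.+ ℤ.+ 2 ℤ.* f n (2 * k)
    ℤ.+ sumFrom (suc (2 * k)) ((n + k) / 2) (f n)
  as-integer = begin
    ℤ.+ (x + 2 * y + s)                     ≡⟨ ℤP.pos-+ (x + 2 * y) s ⟩
    ℤ.+ (x + 2 * y) ℤ.+ ℤ.+ s               ≡⟨ cong (λ z → z ℤ.+ ℤ.+ s) (ℤP.pos-+ x (2 * y)) ⟩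
    ℤ.+ x ℤ.+ ℤ.+ (2 * y) ℤ.+ ℤ.+ s         ≡⟨ cong (λ z → ℤ.+ x ℤ.+ z ℤ.+ ℤ.+ s) (ℤP.pos-* 2 y) ⟩
    ℤ.+ x ℤ.+ ℤ.+ 2 ℤ.* ℤ.+ y ℤ.+ ℤ.+ s     ≡⟨ cong (ℤ._+_ (ℤ.+ x ℤ.+ ℤ.+ 2 ℤ.* ℤ.+ y))
                                                 (sumFromCount-pos (suc (2 * k)) ((n + k) / 2 ∸ 2 * k) (coeff n)) ⟨
    f n (2 * k ∸ 1) ℤ.+ ℤ.+ 2 ℤ.* f n (2 * k) ℤ.+ sumFrom (suc (2 * k)) ((n + k) / 2) (f n) ∎
    where open ≡-Reasoning

coefficient-sum-bound : ∀ {n} t k → n ≡ 2 + 3 * t → 36 ≤ t → 0 < k → k < t →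
  coeff n (2 * k ∸ 1) + 2 * coeff n (2 * k)
    + sumFromCountℕ (suc (2 * k)) ((n + k) / 2 ∸ 2 * k) (coeff n) < coeff n (n ∸ k)
coefficient-sum-bound {n} t k@(suc _) n≡2+3t 36≤t (s≤s z≤n) k<t = begin-strict
  coeff n (2 * k ∸ 1) + 2 * coeff n (2 * k) + sumFromCountℕ (suc (2 * k)) (m ∸ 2 * k) (coeff n)
    <⟨ head-sum-bound (2 * k ∸ 1) (m ∸ 2 * k) m (trans (+-suc (2 * k ∸ 1) _) (m+[n∸m]≡n 2k≤m))
         (grows-mono {8} {5} {coeff n} (s≤s (s≤s (s≤s m≤2t))) (coeff-grows {t = t} n≡2+3t 36≤t))
         (coeff-mono n 2k≤m m≤n)
         (coeff-positive-below-top {t = t} n≡2+3t (3 + m) (s≤s (s≤s (s≤s m≤2t)))) ⟩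
  coeff n (3 + m) ≤⟨ coeff-mono n (midpoint-gap {t = t} n≡2+3t k<t) (m∸n≤m n k) ⟩
  coeff n (n ∸ k) ∎
  where
  open ≤-Reasoning
  m : ℕ
  m = (n + k) / 2
  2k≤m : 2 * k ≤ m
  2k≤m = midpoint-lower {t = t} n≡2+3t k<t
  m≤2t : m ≤ 2 * t
  m≤2t = midpoint-upper {t = t} n≡2+3t k<t
  m≤n : m ≤ n
  m≤n = ≤-trans m≤2t (subst (2 * t ≤_) (trans (regroup t) (sym n≡2+3t)) (m≤m+n (2 * t) (2 + t)))
    where
    regroup : ∀ t → 2 * t + (2 + t) ≡ 2 + 3 * t
    regroup = solve-∀

lemma3p7 : ∃[ N ] ∀ (s : ℕ) → 1 ≤ s → N ≤ 3 * s ∸ 1 → ∀ (k : ℕ) → 0 < k → k < s ∸ 1 →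
    (f (3 * s ∸ 1) (2 * k ∸ 1) ℤ.+ ℤ.+ 2 ℤ.* f (3 * s ∸ 1) (2 * k)
      ℤ.+ sumFrom (suc (2 * k)) ((3 * s ∸ 1 + k) / 2) (f (3 * s ∸ 1))
      - f (3 * s ∸ 1) ((3 * s ∸ 1) ∸ k)) ℤ.< 0ℤ
lemma3p7 = 110 , gap-negative
  where
  gap-negative : ∀ s → 1 ≤ s → 110 ≤ 3 * s ∸ 1 → ∀ k → 0 < k → k < s ∸ 1 → gap (3 * s ∸ 1) k ℤ.< 0ℤ
  gap-negative (suc t) _ 110≤n k 0<k k<t =
    gap<0 (3 * suc t ∸ 1) k (coefficient-sum-bound t k n≡2+3t 36≤t 0<k k<t)
    where
    n≡2+3t : 3 * suc t ∸ 1 ≡ 2 + 3 * t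
    n≡2+3t = cong (_∸ 1) (*-suc 3 t)
    36≤t : 36 ≤ t
    36≤t = *-cancelˡ-≤ 3 (+-cancelˡ-≤ 2 _ _ (subst (110 ≤_) n≡2+3t 110≤n))
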